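{- Let $\alpha$ be an infinite word over $\{0,1,2,3\}$ with infinitely many letters from $\{2,3\}$. Let $\beta=\alpha_k\alpha_{k+1}\cdots\alpha_{k+p-1}$ be a factor of length $p$ having $q$ letters from $\{2,3\}$, where $0<q\le p$, and $p-q$ letters from $\{0,1\}$. Then $H^\alpha_{1,k}((q+4)2^{p-q},p)$ has a vertex-minor isomorphic to $H^\gamma_{1,1}(q,q)$ for some infinite word $\gamma$ using only letters from $\{2,3\}$.
   Context: For an infinite word $\alpha=\alpha_1\alpha_2\cdots$ over $\{0,1,2,3\}$, the infinite graph $\mathcal{P}^\alpha$ has vertex set $\{v_{i,j}: i,j\in\mathbb{N}\}$ ($i$ is the row, $j$ the column). The only edges are between consecutive columns $j$ and $j+1$, determined by $\alpha_j$: if $\alpha_j=0$, $v_{i,j}v_{k,j+1}$ is an edge iff $i=k$; if $\alpha_j=1$, iff $i\neq k$; if $\alpha_j=2$, iff $i\le k$; if $\alpha_j=3$, iff $i\ge k$. $H^\alpha_{i,j}(m,n)$ denotes the induced subgraph of $\mathcal{P}^\alpha$ on $\{v_{x,y}: i\le x\le i+m-1,\ j\le y\le j+n-1\}$. Local complementation at a vertex $v$ replaces the subgraph induced on the neighbourhood of $v$ by its complement; $H$ is a vertex-minor of $G$ if $H$ is obtained (up to isomorphism) from $G$ by a sequence of vertex deletions and local complementations. -}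

module Defs where

open import Data.Nat using (ℕ; zero; suc; _+_; _*_; _≤_; _<_)
open import Data.Nat.Base using (_≡ᵇ_; _≤ᵇ_)
open import Data.Fin using (Fin; toℕ; remQuot; punchIn)
open import Data.Fin.Properties using (_≟_)
open import Data.Bool using (Bool; true; false; _∧_; _∨_; not; _xor_)
open import Data.Product using (Σ; _×_; _,_; proj₁; proj₂; ∃)
open import Data.Sum using (_⊎_)
open import Function.Bundles using (_↔_; Inverse)
open import Relation.Nullary.Decidable using (⌊_⌋)
open import Relation.Binary.PropositionalEquality using (_≡_)

data Letter : Set where
  l0 l1 l2 l3 : Letter

-- An infinite word α = α₁ α₂ ⋯ ; we use 1-based positions, position 0 is ignored.
Word : Set
Word = ℕ → Letter

is23 : Letter → Bool
is23 l2 = true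
is23 l3 = true
is23 _  = false

InfinitelyMany23 : Word → Set
InfinitelyMany23 α = ∀ N → Σ ℕ λ j → N ≤ j × is23 (α j) ≡ true

count23 : Word → ℕ → ℕ → ℕ
count23 α k zero    = 0
count23 α k (suc p) = (if is23 (α k) then 1 else 0) + count23 α (suc k) p
  where open import Data.Bool using (if_then_else_)

-- edge rule between v_{i,j} and v_{k,j+1} determined by α_j
rel : Letter → ℕ → ℕ → Bool
rel l0 i k = i ≡ᵇ k
rel l1 i k = not (i ≡ᵇ k)
rel l2 i k = i ≤ᵇ k
rel l3 i k = k ≤ᵇ i

adjP : Word → ℕ → ℕ → ℕ → ℕ → Bool
adjP α i j i' j' =
  ((suc j ≡ᵇ j') ∧ rel (α j) i i') ∨ ((suc j' ≡ᵇ j) ∧ rel (α j') i' i)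

record Graph : Set where
  constructor mkGraph
  field
    size : ℕ
    adj  : Fin size → Fin size → Bool
open Graph public

-- H^α_{i,j}(m,n): induced subgraph of 𝒫^α on rows i..i+m-1, columns j..j+n-1.
-- Vertex t : Fin (m * n) encodes (x , y) = remQuot n t, i.e. v_{i+x, j+y}.
H : Word → ℕ → ℕ → (m n : ℕ) → Graph
H α i j m n = mkGraph (m * n) λ s t →
  let (x , y)   = remQuot {m} n s
      (x' , y') = remQuot {m} n t
  in adjP α (i + toℕ x) (j + toℕ y) (i + toℕ x') (j + toℕ y')

localComp : (G : Graph) → Fin (size G) → Graph
localComp (mkGraph n a) v = mkGraph n λ x y →
  a x y xor (a v x ∧ a v y ∧ not ⌊ x ≟ y ⌋)

delete : ∀ {n} → (Fin (suc n) → Fin (suc n) → Bool) → Fin (suc n) → Graph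
delete {n} a v = mkGraph n λ x y → a (punchIn v x) (punchIn v y)

Iso : Graph → Graph → Set
Iso G G' = Σ (Fin (size G) ↔ Fin (size G')) λ f →
  ∀ x y → adj G' (Inverse.to f x) (Inverse.to f y) ≡ adj G x y

data VertexMinor (H' : Graph) : Graph → Set where
  done : ∀ {G} → Iso G H' → VertexMinor H' G
  lc   : ∀ G v → VertexMinor H' (localComp G v) → VertexMinor H' G
  del  : ∀ {n} (a : Fin (suc n) → Fin (suc n) → Bool) v →
         VertexMinor H' (delete a v) → VertexMinor H' (mkGraph (suc n) a)

{-# OPTIONS --safe #-}
-- A letter b ∈ {0,1} followed by a letter L ∈ {2,3} can be removed from the
-- grid: local complementation at every vertex of the column between them, then
-- deletion of that column.  As the column is independent, the new adjacency of two
-- remaining vertices is toggled by the parity of their common neighbours in it.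
-- Keeping only every other row (odd rows for L = 2, even ones for L = 3) makes
-- these parities vanish inside a column and reproduce the relation of L between
-- the two columns it separated.  Each elimination halves the rows, so from
-- q · 2^(#letters 0, 1) ≤ (q + 4) · 2^(p − q) rows all letters 0 and 1 can be
-- removed from right to left (a final one just drops the last column), leaving the
-- grid of the letters 2 and 3.  At least q − 1 of them are letters of the grid,
-- so the q × q grid of that {2,3}-word is induced, and the rest is deleted.

module Submission where

open import Defs
open import Data.Nat
  using (ℕ; zero; suc; _+_; _*_; _^_; _∸_; _≤_; _<_; z≤n; s≤s; _≡ᵇ_; NonZero; >-nonZero; pred)
open import Data.Nat.Properties as ℕ using (_≟_; _≤?_)
open import Data.Nat.DivMod using (_mod_; m<n⇒m%n≡m)
open import Data.Fin as Fin using (Fin; toℕ; punchIn; punchOut)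
open import Data.Fin.Properties as Fin using (all?; any?; ¬∀⟶∃¬; punchIn-punchOut; punchOut-injective)
open import Data.Bool using (Bool; true; false; _∧_; _∨_; not; _xor_; if_then_else_)
open import Data.Bool.Properties
  using (∨-comm; ∧-comm; xor-identityʳ; xor-assoc; xor-same; ∧-zeroʳ; ∧-identityʳ; ∨-identityʳ;
         xor-∧-commutativeRing)
open import Algebra.Bundles using (CommutativeRing)
open import Algebra.Properties.CommutativeSemigroup (CommutativeRing.+-commutativeSemigroup xor-∧-commutativeRing)
  using () renaming (interchange to xor-interchange)
open import Data.List using (List; []; _∷_; _++_; map; foldr; length; downFrom)
open import Data.List.Properties
  using (++-assoc; ++-identityʳ; map-∘; map-cong; map-cong-local; length-++-≤ˡ; length-++-sucʳ)
open import Data.List.Membership.Propositional using (_∈_)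
open import Data.List.Membership.Propositional.Properties using (∈-map⁻; ∈-downFrom⁻)
open import Data.List.Relation.Unary.All as All using (All; []; _∷_)
open import Data.List.Relation.Unary.All.Properties using (applyDownFrom⁺₁)
open import Data.List.Relation.Unary.Any using (here; there)
open import Data.Product using (Σ; _×_; _,_; proj₁; proj₂; ∃)
open import Function using (_∘_; _⇔_; mk⇔)
open import Function.Bundles using (mk↔ₛ′; Equivalence)
open import Relation.Nullary using (yes; no; ¬_; contradiction)
open import Relation.Nullary.Decidable using (dec-true; dec-false; does-⇔)
open import Relation.Binary.PropositionalEquality

Adjacency : ℕ → Set
Adjacency n = Fin n → Fin n → Bool

localComps : ∀ {n} → Adjacency n → List (Fin n) → Adjacency n
localComps a []       = a
localComps a (v ∷ vs) = localComps (adj (localComp (mkGraph _ a) v)) vs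

localComps-++ : ∀ {n} (a : Adjacency n) us vs →
                localComps a (us ++ vs) ≡ localComps (localComps a us) vs
localComps-++ a []       vs = refl
localComps-++ a (u ∷ us) vs = localComps-++ _ us vs

vertexMinor-localComps : ∀ {T n} (a : Adjacency n) vs →
  VertexMinor T (mkGraph n (localComps a vs)) → VertexMinor T (mkGraph n a)
vertexMinor-localComps a []       m = m
vertexMinor-localComps a (v ∷ vs) m = lc _ v (vertexMinor-localComps _ vs m)

module _ {T : Graph} where

  vertexMinor-bijection : ∀ n (a : Adjacency n) (g : Fin (size T) → Fin n) →
    (∀ {x y} → g x ≡ g y → x ≡ y) → (∀ v → ∃ λ x → g x ≡ v) →
    (∀ x y → a (g x) (g y) ≡ adj T x y) → VertexMinor T (mkGraph n a)
  vertexMinor-bijection n a g g-inj g-surj g-adj =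
    done (mk↔ₛ′ g⁻¹ g (λ x → g-inj (proj₂ (g-surj (g x)))) (proj₂ ∘ g-surj) , adj-g⁻¹)
    where
    g⁻¹ : Fin n → Fin (size T)
    g⁻¹ = proj₁ ∘ g-surj
    adj-g⁻¹ : ∀ u v → adj T (g⁻¹ u) (g⁻¹ v) ≡ a u v
    adj-g⁻¹ u v = trans (sym (g-adj (g⁻¹ u) (g⁻¹ v))) (cong₂ a (proj₂ (g-surj u)) (proj₂ (g-surj v)))

  vertexMinor-embedding : ∀ n (a : Adjacency n) (g : Fin (size T) → Fin n) →
    (∀ {x y} → g x ≡ g y → x ≡ y) →
    (∀ x y → a (g x) (g y) ≡ adj T x y) → VertexMinor T (mkGraph n a)
  vertexMinor-embedding zero a g g-inj g-adj = vertexMinor-bijection zero a g g-inj (λ ()) g-adj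
  vertexMinor-embedding (suc n) a g g-inj g-adj with all? (λ v → any? (λ x → g x Fin.≟ v))
  ... | yes g-surj = vertexMinor-bijection (suc n) a g g-inj g-surj g-adj
  ... | no ¬g-surj with ¬∀⟶∃¬ (suc n) _ (λ v → any? (λ x → g x Fin.≟ v)) ¬g-surj
  ... | v , v∉img = del a v (vertexMinor-embedding n _ g′ g′-inj g′-adj)
    where
    v≢g : ∀ x → v ≢ g x
    v≢g x v≡gx = v∉img (x , sym v≡gx)
    g′ : Fin (size T) → Fin n
    g′ x = punchOut (v≢g x)
    g′-inj : ∀ {x y} → g′ x ≡ g′ y → x ≡ y
    g′-inj e = g-inj (punchOut-injective (v≢g _) (v≢g _) e)
    g′-adj : ∀ x y → a (punchIn v (g′ x)) (punchIn v (g′ y)) ≡ adj T x y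
    g′-adj x y = trans (cong₂ a (punchIn-punchOut (v≢g x)) (punchIn-punchOut (v≢g y))) (g-adj x y)

parity : List Bool → Bool
parity = foldr _xor_ false

module _ {n} (a : Adjacency n) (v : Fin n) where

  private
    a′ : Adjacency n
    a′ = adj (localComp (mkGraph n a) v)

  localComp-diagonal : ∀ x → a′ x x ≡ a x x
  localComp-diagonal x with x Fin.≟ x
  ... | yes _   = trans (cong (a x x xor_) (trans (cong (a v x ∧_) (∧-zeroʳ _)) (∧-zeroʳ _)))
                        (xor-identityʳ _)
  ... | no x≢x = contradiction refl x≢x

  localComp-offDiagonal : ∀ {x y} → x ≢ y → a′ x y ≡ a x y xor (a v x ∧ a v y)
  localComp-offDiagonal {x} {y} x≢y with x Fin.≟ y
  ... | yes x≡y = contradiction x≡y x≢y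
  ... | no _    = cong (λ b → a x y xor (a v x ∧ b)) (∧-identityʳ _)

  localComp-nonNeighbour : ∀ {w} → a v w ≡ false → ∀ z → a′ w z ≡ a w z
  localComp-nonNeighbour avw≡false z rewrite avw≡false = xor-identityʳ _

localComps-diagonal : ∀ {n} (a : Adjacency n) vs x → localComps a vs x x ≡ a x x
localComps-diagonal a []       x = refl
localComps-diagonal a (v ∷ vs) x = trans (localComps-diagonal _ vs x) (localComp-diagonal a v x)

-- Local complementation at v changes no edge at a non-neighbour of v, so along an
-- independent set every vertex still has its original neighbourhood when its turn comes.
localComps-independent : ∀ {n} (a : Adjacency n) vs →
  (∀ {v w} → v ∈ vs → w ∈ vs → a v w ≡ false) →
  ∀ {x y} → x ≢ y → localComps a vs x y ≡ a x y xor parity (map (λ v → a v x ∧ a v y) vs)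
localComps-independent a []       _     _ = sym (xor-identityʳ _)
localComps-independent a (v ∷ vs) indep {x} {y} x≢y = begin
  localComps a′ vs x y
    ≡⟨ localComps-independent a′ vs indep′ x≢y ⟩
  a′ x y xor parity (map (λ w → a′ w x ∧ a′ w y) vs)
    ≡⟨ cong₂ (λ b bs → b xor parity bs) (localComp-offDiagonal a v x≢y)
         (map-cong-local (All.tabulate λ w∈ → cong₂ _∧_ (unchanged (there w∈) x) (unchanged (there w∈) y))) ⟩
  (a x y xor (a v x ∧ a v y)) xor parity (map (λ w → a w x ∧ a w y) vs)
    ≡⟨ xor-assoc (a x y) _ _ ⟩
  a x y xor parity (map (λ w → a w x ∧ a w y) (v ∷ vs)) ∎
  where
  open ≡-Reasoning
  a′ = adj (localComp (mkGraph _ a) v)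
  unchanged : ∀ {w} → w ∈ v ∷ vs → ∀ z → a′ w z ≡ a w z
  unchanged w∈ = localComp-nonNeighbour a v (indep (here refl) w∈)
  indep′ : ∀ {w w′} → w ∈ vs → w′ ∈ vs → a′ w w′ ≡ false
  indep′ w∈ w′∈ = trans (unchanged (there w∈) _) (indep (there w∈) (there w′∈))

double : ℕ → ℕ
double zero    = zero
double (suc m) = suc (suc (double m))

module _ {A : Set} where

  parity-map-xor : ∀ (g h : A → Bool) xs →
    parity (map (λ x → g x xor h x) xs) ≡ parity (map g xs) xor parity (map h xs)
  parity-map-xor g h []       = refl
  parity-map-xor g h (x ∷ xs) =
    trans (cong ((g x xor h x) xor_) (parity-map-xor g h xs)) (xor-interchange (g x) (h x) _ _)

  parity-map-false : ∀ {g : A → Bool} → (∀ x → g x ≡ false) → ∀ xs → parity (map g xs) ≡ false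
  parity-map-false g≡false []       = refl
  parity-map-false g≡false (x ∷ xs) rewrite g≡false x = parity-map-false g≡false xs

parity-cong-downFrom : ∀ {g h : ℕ → Bool} n → (∀ {w} → w < n → g w ≡ h w) →
  parity (map g (downFrom n)) ≡ parity (map h (downFrom n))
parity-cong-downFrom n g≗h = cong parity (map-cong-local (applyDownFrom⁺₁ _ n g≗h))

parity-pairs : ∀ m (g : ℕ → Bool) → (∀ i → g (double i) ≡ g (suc (double i))) →
  parity (map g (downFrom (double m))) ≡ false
parity-pairs zero    g pair = refl
parity-pairs (suc m) g pair rewrite pair m | parity-pairs m g pair =
  trans (cong (g (suc (double m)) xor_) (xor-identityʳ _)) (xor-same (g (suc (double m))))

-- does (m ≟ n) is definitionally m ≡ᵇ n, the test used by rel l0, so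
-- dec-true and dec-false evaluate it.
parity-indicator-outside : ∀ n r (h : ℕ → Bool) → n ≤ r →
  parity (map (λ w → (r ≡ᵇ w) ∧ h w) (downFrom n)) ≡ false
parity-indicator-outside zero    r h _     = refl
parity-indicator-outside (suc n) r h n<r rewrite dec-false (r ≟ n) (ℕ.>⇒≢ n<r) =
  parity-indicator-outside n r h (ℕ.<⇒≤ n<r)

parity-indicator : ∀ n r (h : ℕ → Bool) → r < n →
  parity (map (λ w → (r ≡ᵇ w) ∧ h w) (downFrom n)) ≡ h r
parity-indicator (suc n) r h r<1+n with r ≟ n
... | yes refl rewrite dec-true (r ≟ r) refl | parity-indicator-outside r r h ℕ.≤-refl =
  xor-identityʳ (h r)
... | no r≢n rewrite dec-false (r ≟ n) r≢n =
  parity-indicator n r h (ℕ.≤∧≢⇒< (ℕ.≤-pred r<1+n) r≢n)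

parity-removePoint : ∀ n r (h : ℕ → Bool) → r < n →
  parity (map (λ w → not (r ≡ᵇ w) ∧ h w) (downFrom n)) ≡ parity (map h (downFrom n)) xor h r
parity-removePoint n r h r<n = begin
  parity (map (λ w → not (r ≡ᵇ w) ∧ h w) (downFrom n))
    ≡⟨ cong parity (map-cong (λ w → not-∧ (r ≡ᵇ w) (h w)) (downFrom n)) ⟩
  parity (map (λ w → h w xor ((r ≡ᵇ w) ∧ h w)) (downFrom n))
    ≡⟨ parity-map-xor h _ (downFrom n) ⟩
  parity (map h (downFrom n)) xor parity (map (λ w → (r ≡ᵇ w) ∧ h w) (downFrom n))
    ≡⟨ cong (parity (map h (downFrom n)) xor_) (parity-indicator n r h r<n) ⟩
  parity (map h (downFrom n)) xor h r ∎
  where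
  open ≡-Reasoning
  not-∧ : ∀ b c → not b ∧ c ≡ c xor (b ∧ c)
  not-∧ true  c = sym (xor-same c)
  not-∧ false c = sym (xor-identityʳ c)

OrderEmbedding : (ℕ → ℕ) → Set
OrderEmbedding f = ∀ {a b} → f a ≤ f b ⇔ a ≤ b

module _ {f : ℕ → ℕ} (f-emb : OrderEmbedding f) where

  orderEmbedding-injective : ∀ {a b} → f a ≡ f b → a ≡ b
  orderEmbedding-injective e =
    ℕ.≤-antisym (Equivalence.to f-emb (ℕ.≤-reflexive e)) (Equivalence.to f-emb (ℕ.≤-reflexive (sym e)))

  rel-orderEmbedding : ∀ l a b → rel l (f a) (f b) ≡ rel l a b
  rel-orderEmbedding l0 a b = does-⇔ (mk⇔ orderEmbedding-injective (cong f)) (f a ≟ f b) (a ≟ b)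
  rel-orderEmbedding l1 a b = cong not (rel-orderEmbedding l0 a b)
  rel-orderEmbedding l2 a b = does-⇔ f-emb (f a ≤? f b) (a ≤? b)
  rel-orderEmbedding l3 a b = does-⇔ f-emb (f b ≤? f a) (b ≤? a)

suc-orderEmbedding : OrderEmbedding suc
suc-orderEmbedding = mk⇔ ℕ.≤-pred s≤s

double-mono : ∀ {a b} → a ≤ b → double a ≤ double b
double-mono z≤n       = z≤n
double-mono (s≤s a≤b) = s≤s (s≤s (double-mono a≤b))

double-≤-suc⇒≤ : ∀ {a b} → double a ≤ suc (double b) → a ≤ b
double-≤-suc⇒≤ {zero}              _                 = z≤n
double-≤-suc⇒≤ {suc a} {zero}      (s≤s ())
double-≤-suc⇒≤ {suc a} {suc b}     (s≤s (s≤s le))    = s≤s (double-≤-suc⇒≤ le)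

double-orderEmbedding : OrderEmbedding double
double-orderEmbedding = mk⇔ (double-≤-suc⇒≤ ∘ ℕ.m≤n⇒m≤1+n) double-mono

-- The rows kept when a letter 0 or 1 before L is eliminated.  Their parity is
-- chosen so that rows 2i and 2i+1 relate to every kept row in the same way
-- under L (rel-spread-pair), hence their contributions cancel.
spread : Letter → ℕ → ℕ
spread l2 x = suc (double x)
spread _  x = double x

spread-orderEmbedding : ∀ L → OrderEmbedding (spread L)
spread-orderEmbedding l0 = double-orderEmbedding
spread-orderEmbedding l1 = double-orderEmbedding
spread-orderEmbedding l2 = mk⇔ (Equivalence.to double-orderEmbedding ∘ ℕ.≤-pred) (s≤s ∘ double-mono)
spread-orderEmbedding l3 = double-orderEmbedding

spread-< : ∀ L {a b} → a < b → spread L a < double b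
spread-< L {a} a<b = ℕ.<-≤-trans (s≤s (spread≤ L)) (double-mono a<b)
  where
  spread≤ : ∀ L → spread L a ≤ suc (double a)
  spread≤ l0 = ℕ.n≤1+n _
  spread≤ l1 = ℕ.n≤1+n _
  spread≤ l2 = ℕ.≤-refl
  spread≤ l3 = ℕ.n≤1+n _

rel-spread-pair : ∀ L x i → is23 L ≡ true →
  rel L (double i) (spread L x) ≡ rel L (suc (double i)) (spread L x)
rel-spread-pair l2 x i _ = does-⇔
  (mk⇔ (s≤s ∘ double-mono ∘ double-≤-suc⇒≤) (ℕ.≤-trans (ℕ.n≤1+n _)))
  (double i ≤? suc (double x)) (suc (double i) ≤? suc (double x))
rel-spread-pair l3 x i _ = does-⇔
  (mk⇔ ℕ.m≤n⇒m≤1+n (double-mono ∘ double-≤-suc⇒≤))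
  (double x ≤? double i) (double x ≤? suc (double i))

module _ (w : Word) where

  private
    2+y≢y : ∀ y → suc (suc y) ≢ y
    2+y≢y y = ℕ.>⇒≢ (ℕ.m<n⇒m<1+n (ℕ.n<1+n y))

  adjP-right : ∀ x y x′ → adjP w x y x′ (suc y) ≡ rel (w y) x x′
  adjP-right x y x′ rewrite dec-true (y ≟ y) refl | dec-false (suc (suc y) ≟ y) (2+y≢y y) =
    ∨-identityʳ _

  adjP-left : ∀ x y x′ → adjP w x (suc y) x′ y ≡ rel (w y) x′ x
  adjP-left x y x′ rewrite dec-false (suc (suc y) ≟ y) (2+y≢y y) | dec-true (y ≟ y) refl = refl

  adjP-far : ∀ x {y} x′ {y′} → y′ ≢ suc y → y ≢ suc y′ → adjP w x y x′ y′ ≡ false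
  adjP-far x {y} x′ {y′} y′≢1+y y≢1+y′
    rewrite dec-false (suc y ≟ y′) (y′≢1+y ∘ sym) | dec-false (suc y′ ≟ y) (y≢1+y′ ∘ sym) = refl

  adjP-sameColumn : ∀ x y x′ → adjP w x y x′ y ≡ false
  adjP-sameColumn x y x′ = adjP-far x x′ (ℕ.<⇒≢ (ℕ.n<1+n y)) (ℕ.<⇒≢ (ℕ.n<1+n y))

adjP-shift : ∀ (α : Word) k x y x′ y′ →
  adjP α (suc x) (k + y) (suc x′) (k + y′) ≡ adjP (λ j → α (k + j)) x y x′ y′
adjP-shift α k x y x′ y′ =
  cong₂ _∨_ (cong₂ _∧_ (≡ᵇ-+ k y y′) (rel-orderEmbedding suc-orderEmbedding (α (k + y)) x x′))
            (cong₂ _∧_ (≡ᵇ-+ k y′ y) (rel-orderEmbedding suc-orderEmbedding (α (k + y′)) x′ x))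
  where
  ≡ᵇ-+ : ∀ k y y′ → (suc (k + y) ≡ᵇ k + y′) ≡ (suc y ≡ᵇ y′)
  ≡ᵇ-+ zero    y y′ = refl
  ≡ᵇ-+ (suc k) y y′ = ≡ᵇ-+ k y y′

adjP-cong : ∀ {w w′ : Word} B → (∀ {j} → j < B → w j ≡ w′ j) →
  ∀ x {y} x′ {y′} → y ≤ B → y′ ≤ B → adjP w x y x′ y′ ≡ adjP w′ x y x′ y′
adjP-cong {w} {w′} B w≗w′ x {y} x′ {y′} y≤B y′≤B with y′ ≟ suc y | y ≟ suc y′
... | yes refl | _        = trans (adjP-right w x y x′)
                              (trans (cong (λ l → rel l x x′) (w≗w′ y′≤B)) (sym (adjP-right w′ x y x′)))
... | no _     | yes refl = trans (adjP-left w x y′ x′)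
                              (trans (cong (λ l → rel l x′ x) (w≗w′ y≤B)) (sym (adjP-left w′ x y′ x′)))
... | no y′≢   | no y≢    = trans (adjP-far w x x′ y′≢ y≢) (sym (adjP-far w′ x x′ y′≢ y≢))

-- Padding with the letter 2 keeps the word of a list of letters 2 and 3 over {2,3}.
wordOf : List Letter → Word
wordOf []       _       = l2
wordOf (a ∷ ls) zero    = a
wordOf (a ∷ ls) (suc j) = wordOf ls j

wordOf-at : ∀ pre (a : Letter) rest → wordOf (pre ++ a ∷ rest) (length pre) ≡ a
wordOf-at []        a rest = refl
wordOf-at (_ ∷ pre) a rest = wordOf-at pre a rest

wordOf-at-suc : ∀ pre (a b : Letter) rest → wordOf (pre ++ a ∷ b ∷ rest) (suc (length pre)) ≡ b
wordOf-at-suc []        a b rest = refl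
wordOf-at-suc (_ ∷ pre) a b rest = wordOf-at-suc pre a b rest

-- skip c y is y for y ≤ c and y + 1 otherwise: it jumps over column c + 1.
skip : ℕ → ℕ → ℕ
skip zero    zero    = zero
skip zero    (suc y) = suc (suc y)
skip (suc c) zero    = zero
skip (suc c) (suc y) = suc (skip c y)

skip-injective : ∀ c {y y′} → skip c y ≡ skip c y′ → y ≡ y′
skip-injective zero    {zero}  {zero}   _ = refl
skip-injective zero    {suc y} {suc y′} e = ℕ.suc-injective e
skip-injective (suc c) {zero}  {zero}   _ = refl
skip-injective (suc c) {suc y} {suc y′} e = cong suc (skip-injective c (ℕ.suc-injective e))

skip-self : ∀ c → skip c c ≡ c
skip-self zero    = refl
skip-self (suc c) = cong suc (skip-self c)

skip-suc : ∀ c → skip c (suc c) ≡ suc (suc c)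
skip-suc zero    = refl
skip-suc (suc c) = cong suc (skip-suc c)

zero-≡ᵇ-skip : ∀ c y → (zero ≡ᵇ skip c y) ≡ (zero ≡ᵇ y)
zero-≡ᵇ-skip zero    zero    = refl
zero-≡ᵇ-skip zero    (suc y) = refl
zero-≡ᵇ-skip (suc c) zero    = refl
zero-≡ᵇ-skip (suc c) (suc y) = refl

skip-≤ : ∀ c y → skip c y ≤ suc y
skip-≤ zero    zero    = z≤n
skip-≤ zero    (suc y) = ℕ.≤-refl
skip-≤ (suc c) zero    = z≤n
skip-≤ (suc c) (suc y) = s≤s (skip-≤ c y)

adjP-skip : ∀ pre (a L : Letter) fs x y x′ y′ →
  ¬ (y ≡ length pre × y′ ≡ suc (length pre)) →
  ¬ (y′ ≡ length pre × y ≡ suc (length pre)) →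
  adjP (wordOf (pre ++ a ∷ L ∷ fs)) x (skip (length pre) y) x′ (skip (length pre) y′)
    ≡ adjP (wordOf (pre ++ L ∷ fs)) x y x′ y′
adjP-skip []        a L fs x zero          x′ zero           _  _  = refl
adjP-skip []        a L fs x zero          x′ (suc zero)     ne _  = contradiction (refl , refl) ne
adjP-skip []        a L fs x zero          x′ (suc (suc y′)) _  _  = refl
adjP-skip []        a L fs x (suc zero)    x′ zero           _  ne = contradiction (refl , refl) ne
adjP-skip []        a L fs x (suc (suc y)) x′ zero           _  _  = refl
adjP-skip []        a L fs x (suc y)       x′ (suc y′)       _  _  = refl
adjP-skip (b ∷ pre) a L fs x zero          x′ zero           _  _  = refl
adjP-skip (b ∷ pre) a L fs x zero          x′ (suc y′)       _  _  =
  cong (λ t → (t ∧ rel b x x′) ∨ false) (zero-≡ᵇ-skip (length pre) y′)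
adjP-skip (b ∷ pre) a L fs x (suc y)       x′ zero           _  _  =
  cong (λ t → false ∨ (t ∧ rel b x′ x)) (zero-≡ᵇ-skip (length pre) y)
adjP-skip (b ∷ pre) a L fs x (suc y)       x′ (suc y′)       ne ne′ =
  adjP-skip pre a L fs x y x′ y′ (λ (p , q) → ne (cong suc p , cong suc q))
                                 (λ (p , q) → ne′ (cong suc p , cong suc q))

adjP-sym : ∀ (w : Word) x y x′ y′ → adjP w x y x′ y′ ≡ adjP w x′ y′ x y
adjP-sym w x y x′ y′ = ∨-comm ((suc y ≡ᵇ y′) ∧ rel (w y) x x′) _

adjP-orderEmbedding : ∀ {f} → OrderEmbedding f → ∀ (w : Word) x y x′ y′ →
  adjP w (f x) y (f x′) y′ ≡ adjP w x y x′ y′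
adjP-orderEmbedding f-emb w x y x′ y′ =
  cong₂ _∨_ (cong ((suc y ≡ᵇ y′) ∧_) (rel-orderEmbedding f-emb (w y) x x′))
            (cong ((suc y′ ≡ᵇ y) ∧_) (rel-orderEmbedding f-emb (w y′) x′ x))

rel-spread : ∀ L l a b → rel l (spread L a) (spread L b) ≡ rel l a b
rel-spread L = rel-orderEmbedding (spread-orderEmbedding L)

module _ (L : Letter) (m : ℕ) where

  private
    s = spread L
    ⨁ : (ℕ → Bool) → Bool
    ⨁ g = parity (map g (downFrom (double m)))

    spread-≢ᵇ : ∀ {x x′} → x ≢ x′ → (s x ≡ᵇ s x′) ≡ false
    spread-≢ᵇ x≢x′ = dec-false (s _ ≟ s _) (x≢x′ ∘ orderEmbedding-injective (spread-orderEmbedding L))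

  parity-across : ∀ b x x′ → is23 b ≡ false → is23 L ≡ true → x < m →
    ⨁ (λ w → rel b (s x) w ∧ rel L w (s x′)) ≡ rel L x x′
  parity-across l0 x x′ _ _ x<m =
    trans (parity-indicator _ (s x) _ (spread-< L x<m)) (rel-spread L L x x′)
  parity-across l1 x x′ _ L∈23 x<m = begin
    ⨁ (λ w → not (s x ≡ᵇ w) ∧ rel L w (s x′))
      ≡⟨ parity-removePoint _ (s x) _ (spread-< L x<m) ⟩
    ⨁ (λ w → rel L w (s x′)) xor rel L (s x) (s x′)
      ≡⟨ cong₂ _xor_ (parity-pairs m _ (λ i → rel-spread-pair L x′ i L∈23)) (rel-spread L L x x′) ⟩
    rel L x x′ ∎
    where open ≡-Reasoning

  parity-sameSide : ∀ b x x′ → is23 b ≡ false → x < m → x′ < m → x ≢ x′ →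
    ⨁ (λ w → rel b (s x) w ∧ rel b (s x′) w) ≡ false
  parity-sameSide l0 x x′ _ x<m _ x≢x′ =
    trans (parity-indicator _ (s x) _ (spread-< L x<m)) (spread-≢ᵇ (x≢x′ ∘ sym))
  parity-sameSide l1 x x′ _ x<m x′<m x≢x′ = begin
    ⨁ (λ w → not (s x ≡ᵇ w) ∧ not (s x′ ≡ᵇ w))
      ≡⟨ parity-removePoint _ (s x) _ (spread-< L x<m) ⟩
    ⨁ (λ w → not (s x′ ≡ᵇ w)) xor not (s x′ ≡ᵇ s x)
      ≡⟨ cong₂ _xor_ allButOne (cong not (spread-≢ᵇ (x≢x′ ∘ sym))) ⟩
    false ∎
    where
    open ≡-Reasoning
    allButOne : ⨁ (λ w → not (s x′ ≡ᵇ w)) ≡ true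
    allButOne = begin
      ⨁ (λ w → not (s x′ ≡ᵇ w))
        ≡⟨ cong parity (map-cong (λ _ → sym (∧-identityʳ _)) (downFrom (double m))) ⟩
      ⨁ (λ w → not (s x′ ≡ᵇ w) ∧ true)
        ≡⟨ parity-removePoint _ (s x′) _ (spread-< L x′<m) ⟩
      ⨁ (λ _ → true) xor true
        ≡⟨ cong (_xor true) (parity-pairs m _ (λ _ → refl)) ⟩
      true ∎

  parity-farSide : ∀ x x′ → is23 L ≡ true → ⨁ (λ w → rel L w (s x) ∧ rel L w (s x′)) ≡ false
  parity-farSide x x′ L∈23 =
    parity-pairs m _ (λ i → cong₂ _∧_ (rel-spread-pair L x i L∈23) (rel-spread-pair L x′ i L∈23))

module Elimination (pre : List Letter) (b L : Letter) (fs : List Letter) (m : ℕ)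
                   (b∉23 : is23 b ≡ false) (L∈23 : is23 L ≡ true) where

  open ≡-Reasoning

  c : ℕ
  c = length pre

  ℓ ℓ′ : Word
  ℓ  = wordOf (pre ++ b ∷ L ∷ fs)
  ℓ′ = wordOf (pre ++ L ∷ fs)

  private
    s = spread L
    ⨁ : (ℕ → Bool) → Bool
    ⨁ g = parity (map g (downFrom (double m)))

  middle : ℕ → ℕ → ℕ → Bool
  middle x y w = adjP ℓ w (suc c) (s x) (skip c y)

  contracted : ℕ → ℕ → ℕ → ℕ → Bool
  contracted x y x′ y′ =
    adjP ℓ (s x) (skip c y) (s x′) (skip c y′) xor ⨁ (λ w → middle x y w ∧ middle x′ y′ w)

  middle-left : ∀ x w → middle x c w ≡ rel b (s x) w
  middle-left x w = begin
    adjP ℓ w (suc c) (s x) (skip c c) ≡⟨ cong (adjP ℓ w (suc c) (s x)) (skip-self c) ⟩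
    adjP ℓ w (suc c) (s x) c          ≡⟨ adjP-left ℓ w c (s x) ⟩
    rel (ℓ c) (s x) w                 ≡⟨ cong (λ l → rel l (s x) w) (wordOf-at pre b (L ∷ fs)) ⟩
    rel b (s x) w                     ∎

  middle-right : ∀ x w → middle x (suc c) w ≡ rel L w (s x)
  middle-right x w = begin
    adjP ℓ w (suc c) (s x) (skip c (suc c)) ≡⟨ cong (adjP ℓ w (suc c) (s x)) (skip-suc c) ⟩
    adjP ℓ w (suc c) (s x) (suc (suc c))    ≡⟨ adjP-right ℓ w (suc c) (s x) ⟩
    rel (ℓ (suc c)) w (s x)                 ≡⟨ cong (λ l → rel l w (s x)) (wordOf-at-suc pre b L fs) ⟩
    rel L w (s x)                           ∎

  middle-far : ∀ x {y} w → y ≢ c → y ≢ suc c → middle x y w ≡ false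
  middle-far x w y≢c y≢1+c = adjP-far ℓ w (s x)
    (λ e → y≢1+c (skip-injective c (trans e (sym (skip-suc c)))))
    (λ e → y≢c (skip-injective c (trans (sym (ℕ.suc-injective e)) (sym (skip-self c)))))

  contracted-sym : ∀ x y x′ y′ → contracted x y x′ y′ ≡ contracted x′ y′ x y
  contracted-sym x y x′ y′ = cong₂ _xor_ (adjP-sym ℓ (s x) (skip c y) (s x′) (skip c y′))
    (cong parity (map-cong (λ w → ∧-comm (middle x y w) _) (downFrom (double m))))

  contracted-far : ∀ x {y} x′ y′ → y ≢ c → y ≢ suc c → contracted x y x′ y′ ≡ adjP ℓ′ x y x′ y′
  contracted-far x {y} x′ y′ y≢c y≢1+c = begin
    contracted x y x′ y′
      ≡⟨ cong (adjP ℓ (s x) (skip c y) (s x′) (skip c y′) xor_)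
           (parity-map-false (λ w → cong (_∧ middle x′ y′ w) (middle-far x w y≢c y≢1+c))
             (downFrom (double m))) ⟩
    adjP ℓ (s x) (skip c y) (s x′) (skip c y′) xor false
      ≡⟨ xor-identityʳ _ ⟩
    adjP ℓ (s x) (skip c y) (s x′) (skip c y′)
      ≡⟨ adjP-orderEmbedding (spread-orderEmbedding L) ℓ x (skip c y) x′ (skip c y′) ⟩
    adjP ℓ x (skip c y) x′ (skip c y′)
      ≡⟨ adjP-skip pre b L fs x y x′ y′ (y≢c ∘ proj₁) (y≢1+c ∘ proj₂) ⟩
    adjP ℓ′ x y x′ y′ ∎

  contracted-left : ∀ x x′ → x < m → x′ < m → x ≢ x′ → contracted x c x′ c ≡ adjP ℓ′ x c x′ c
  contracted-left x x′ x<m x′<m x≢x′ = trans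
    (cong₂ _xor_ (adjP-sameColumn ℓ (s x) (skip c c) (s x′))
      (trans (cong parity (map-cong (λ w → cong₂ _∧_ (middle-left x w) (middle-left x′ w)) (downFrom (double m))))
             (parity-sameSide L m b x x′ b∉23 x<m x′<m x≢x′)))
    (sym (adjP-sameColumn ℓ′ x c x′))

  contracted-right : ∀ x x′ → contracted x (suc c) x′ (suc c) ≡ adjP ℓ′ x (suc c) x′ (suc c)
  contracted-right x x′ = trans
    (cong₂ _xor_ (adjP-sameColumn ℓ (s x) (skip c (suc c)) (s x′))
      (trans (cong parity (map-cong (λ w → cong₂ _∧_ (middle-right x w) (middle-right x′ w)) (downFrom (double m))))
             (parity-farSide L m x x′ L∈23)))
    (sym (adjP-sameColumn ℓ′ x (suc c) x′))

  contracted-across : ∀ x x′ → x < m → contracted x c x′ (suc c) ≡ adjP ℓ′ x c x′ (suc c)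
  contracted-across x x′ x<m = begin
    contracted x c x′ (suc c)
      ≡⟨ cong₂ _xor_ noDirectEdge
           (cong parity (map-cong (λ w → cong₂ _∧_ (middle-left x w) (middle-right x′ w)) (downFrom (double m)))) ⟩
    false xor ⨁ (λ w → rel b (s x) w ∧ rel L w (s x′))
      ≡⟨ parity-across L m b x x′ b∉23 L∈23 x<m ⟩
    rel L x x′
      ≡⟨ cong (λ l → rel l x x′) (wordOf-at pre L fs) ⟨
    rel (ℓ′ c) x x′
      ≡⟨ adjP-right ℓ′ x c x′ ⟨
    adjP ℓ′ x c x′ (suc c) ∎
    where
    noDirectEdge : adjP ℓ (s x) (skip c c) (s x′) (skip c (suc c)) ≡ false
    noDirectEdge rewrite skip-self c | skip-suc c =
      adjP-far ℓ (s x) {c} (s x′) {suc (suc c)}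
        (ℕ.>⇒≢ (ℕ.n<1+n (suc c))) (ℕ.<⇒≢ (ℕ.m<n⇒m<1+n (ℕ.m<n⇒m<1+n (ℕ.n<1+n c))))

  contracted-adj : ∀ {x y x′ y′} → x < m → x′ < m → ¬ (x ≡ x′ × y ≡ y′) →
    contracted x y x′ y′ ≡ adjP ℓ′ x y x′ y′
  contracted-adj {x} {y} {x′} {y′} x<m x′<m ≢ with y ≟ c | y ≟ suc c | y′ ≟ c | y′ ≟ suc c
  ... | no y≢c | no y≢1+c | _        | _          = contracted-far x x′ y′ y≢c y≢1+c
  ... | _      | _        | no y′≢c  | no y′≢1+c  =
    trans (contracted-sym x y x′ y′)
          (trans (contracted-far x′ x y y′≢c y′≢1+c) (adjP-sym ℓ′ x′ y′ x y))
  ... | yes refl | _      | yes refl | _          = contracted-left x x′ x<m x′<m (λ x≡x′ → ≢ (x≡x′ , refl))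
  ... | yes refl | _      | _        | yes refl   = contracted-across x x′ x<m
  ... | _        | yes refl | yes refl | _        =
    trans (contracted-sym x y x′ y′)
          (trans (contracted-across x′ x x′<m) (adjP-sym ℓ′ x′ c x (suc c)))
  ... | _        | yes refl | _        | yes refl = contracted-right x x′

wordOf-++-< : ∀ pre rest {j} → j < length pre → wordOf (pre ++ rest) j ≡ wordOf pre j
wordOf-++-< (a ∷ pre) rest {zero}  _         = refl
wordOf-++-< (a ∷ pre) rest {suc j} (s≤s j<) = wordOf-++-< pre rest j<

-- Realises a ls m: local complementations turn a into a graph containing, as an
-- induced subgraph, the grid H^ls_{1,1}(m, length ls + 1) of the word ls.
record Realises {n} (a : Adjacency n) (ls : List Letter) (m : ℕ) : Set where
  field
    comps           : List (Fin n)
    label           : ℕ → ℕ → Fin n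
    label-injective : ∀ {x y x′ y′} → x < m → y ≤ length ls → x′ < m → y′ ≤ length ls →
                      label x y ≡ label x′ y′ → x ≡ x′ × y ≡ y′
    label-adj       : ∀ {x y x′ y′} → x < m → y ≤ length ls → x′ < m → y′ ≤ length ls →
                      localComps a comps (label x y) (label x′ y′) ≡ adjP (wordOf ls) x y x′ y′

module _ {n} {a : Adjacency n} where

  realises-fewerRows : ∀ {ls m m′} → m′ ≤ m → Realises a ls m → Realises a ls m′
  realises-fewerRows m′≤m R = record
    { comps           = comps
    ; label           = label
    ; label-injective = λ x< y≤ x′< y′≤ → label-injective (shrink x<) y≤ (shrink x′<) y′≤
    ; label-adj       = λ x< y≤ x′< y′≤ → label-adj (shrink x<) y≤ (shrink x′<) y′≤
    }
    where
    open Realises R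
    shrink : ∀ {x} → x < _ → x < _
    shrink x< = ℕ.<-≤-trans x< m′≤m

  realises-init : ∀ pre b {m} → Realises a (pre ++ b ∷ []) m → Realises a pre m
  realises-init pre b R = record
    { comps           = comps
    ; label           = label
    ; label-injective = λ x< y≤ x′< y′≤ → label-injective x< (widen y≤) x′< (widen y′≤)
    ; label-adj       = λ {x} {y} {x′} {y′} x< y≤ x′< y′≤ →
        trans (label-adj x< (widen y≤) x′< (widen y′≤))
              (adjP-cong (length pre) (wordOf-++-< pre (b ∷ [])) x x′ y≤ y′≤)
    }
    where
    open Realises R
    widen : ∀ {y} → y ≤ length pre → y ≤ length (pre ++ b ∷ [])
    widen y≤ = ℕ.≤-trans y≤ (length-++-≤ˡ pre)

  realises-eliminate : ∀ pre b L fs m → is23 b ≡ false → is23 L ≡ true →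
    Realises a (pre ++ b ∷ L ∷ fs) (double m) → Realises a (pre ++ L ∷ fs) m
  realises-eliminate pre b L fs m b∉23 L∈23 R = record
    { comps           = comps ++ column
    ; label           = label′
    ; label-injective = label′-injective
    ; label-adj       = label′-adj
    }
    where
    open Realises R
    open Elimination pre b L fs m b∉23 L∈23

    longer : length (pre ++ b ∷ L ∷ fs) ≡ suc (length (pre ++ L ∷ fs))
    longer = length-++-sucʳ pre b (L ∷ fs)

    middle-bound : suc c ≤ length (pre ++ b ∷ L ∷ fs)
    middle-bound = subst (suc c ≤_) (sym longer) (s≤s (length-++-≤ˡ pre))

    skip-bound : ∀ {y} → y ≤ length (pre ++ L ∷ fs) → skip c y ≤ length (pre ++ b ∷ L ∷ fs)
    skip-bound y≤ = ℕ.≤-trans (skip-≤ c _) (subst (suc _ ≤_) (sym longer) (s≤s y≤))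

    a′ : Adjacency n
    a′ = localComps a comps

    cell : ℕ → Fin n
    cell w = label w (suc c)

    column : List (Fin n)
    column = map cell (downFrom (double m))

    column-independent : ∀ {v v′} → v ∈ column → v′ ∈ column → a′ v v′ ≡ false
    column-independent v∈ v′∈ with ∈-map⁻ cell v∈ | ∈-map⁻ cell v′∈
    ... | w , w∈ , refl | w′ , w′∈ , refl =
      trans (label-adj (∈-downFrom⁻ w∈) middle-bound (∈-downFrom⁻ w′∈) middle-bound)
            (adjP-sameColumn ℓ w (suc c) w′)

    label′ : ℕ → ℕ → Fin n
    label′ x y = label (spread L x) (skip c y)

    label′-injective : ∀ {x y x′ y′} → x < m → y ≤ length (pre ++ L ∷ fs) →
      x′ < m → y′ ≤ length (pre ++ L ∷ fs) → label′ x y ≡ label′ x′ y′ → x ≡ x′ × y ≡ y′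
    label′-injective x< y≤ x′< y′≤ e
      with label-injective (spread-< L x<) (skip-bound y≤) (spread-< L x′<) (skip-bound y′≤) e
    ... | e₁ , e₂ = orderEmbedding-injective (spread-orderEmbedding L) e₁ , skip-injective c e₂

    offDiagonal : ∀ {x y x′ y′} → x < m → y ≤ length (pre ++ L ∷ fs) →
      x′ < m → y′ ≤ length (pre ++ L ∷ fs) → ¬ (x ≡ x′ × y ≡ y′) →
      localComps a (comps ++ column) (label′ x y) (label′ x′ y′) ≡ adjP ℓ′ x y x′ y′
    offDiagonal {x} {y} {x′} {y′} x< y≤ x′< y′≤ ≢ = begin
      localComps a (comps ++ column) u v
        ≡⟨ cong (λ g → g u v) (localComps-++ a comps column) ⟩
      localComps a′ column u v
        ≡⟨ localComps-independent a′ column column-independent (≢ ∘ label′-injective x< y≤ x′< y′≤) ⟩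
      a′ u v xor parity (map (λ z → a′ z u ∧ a′ z v) column)
        ≡⟨ cong (λ bs → a′ u v xor parity bs) (map-∘ (downFrom (double m))) ⟨
      a′ u v xor parity (map (λ w → a′ (cell w) u ∧ a′ (cell w) v) (downFrom (double m)))
        ≡⟨ cong₂ _xor_ (label-adj (spread-< L x<) (skip-bound y≤) (spread-< L x′<) (skip-bound y′≤))
             (parity-cong-downFrom (double m) λ w< → cong₂ _∧_
               (label-adj w< middle-bound (spread-< L x<) (skip-bound y≤))
               (label-adj w< middle-bound (spread-< L x′<) (skip-bound y′≤))) ⟩
      contracted x y x′ y′
        ≡⟨ contracted-adj x< x′< ≢ ⟩
      adjP ℓ′ x y x′ y′ ∎
      where
      open ≡-Reasoning
      u = label′ x y
      v = label′ x′ y′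

    label′-adj : ∀ {x y x′ y′} → x < m → y ≤ length (pre ++ L ∷ fs) →
      x′ < m → y′ ≤ length (pre ++ L ∷ fs) →
      localComps a (comps ++ column) (label′ x y) (label′ x′ y′) ≡ adjP ℓ′ x y x′ y′
    label′-adj {x} {y} {x′} {y′} x< y≤ x′< y′≤ with x ≟ x′ | y ≟ y′
    ... | yes refl | yes refl = begin
      localComps a (comps ++ column) (label′ x y) (label′ x y)
        ≡⟨ cong (λ g → g (label′ x y) (label′ x y)) (localComps-++ a comps column) ⟩
      localComps a′ column (label′ x y) (label′ x y)
        ≡⟨ localComps-diagonal a′ column (label′ x y) ⟩
      a′ (label′ x y) (label′ x y)
        ≡⟨ label-adj (spread-< L x<) (skip-bound y≤) (spread-< L x<) (skip-bound y≤) ⟩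
      adjP ℓ (spread L x) (skip c y) (spread L x) (skip c y)
        ≡⟨ adjP-sameColumn ℓ (spread L x) (skip c y) (spread L x) ⟩
      false
        ≡⟨ adjP-sameColumn ℓ′ x y x ⟨
      adjP ℓ′ x y x y ∎
      where open ≡-Reasoning
    ... | no x≢x′ | _        = offDiagonal x< y≤ x′< y′≤ (x≢x′ ∘ proj₁)
    ... | _       | no y≢y′  = offDiagonal x< y≤ x′< y′≤ (y≢y′ ∘ proj₂)

letters23 : List Letter → List Letter
letters23 []       = []
letters23 (l ∷ ls) = if is23 l then l ∷ letters23 ls else letters23 ls

count01 : List Letter → ℕ
count01 []       = 0
count01 (l ∷ ls) = if is23 l then count01 ls else suc (count01 ls)

rowsNeeded : ℕ → List Letter → ℕ
rowsNeeded m []       = m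
rowsNeeded m (l ∷ ls) = rowsNeeded (if is23 l then m else double m) ls

letters23-all : ∀ ls → All (λ l → is23 l ≡ true) (letters23 ls)
letters23-all []       = []
letters23-all (l ∷ ls) with is23 l in l∈23
... | true  = l∈23 ∷ letters23-all ls
... | false = letters23-all ls

double≡2* : ∀ m → double m ≡ 2 * m
double≡2* zero    = refl
double≡2* (suc m) = cong suc (trans (cong suc (double≡2* m)) (sym (ℕ.+-suc m (m + 0))))

rowsNeeded≡ : ∀ m ls → rowsNeeded m ls ≡ m * 2 ^ count01 ls
rowsNeeded≡ m []       = sym (ℕ.*-identityʳ m)
rowsNeeded≡ m (l ∷ ls) with is23 l
... | true  = rowsNeeded≡ m ls
... | false = begin
  rowsNeeded (double m) ls   ≡⟨ rowsNeeded≡ (double m) ls ⟩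
  double m * 2 ^ count01 ls  ≡⟨ cong (_* 2 ^ count01 ls) (trans (double≡2* m) (ℕ.*-comm 2 m)) ⟩
  m * 2 * 2 ^ count01 ls     ≡⟨ ℕ.*-assoc m 2 _ ⟩
  m * 2 ^ suc (count01 ls)   ∎
  where open ≡-Reasoning

module _ {n} {a : Adjacency n} where

  realises-eliminate01 : ∀ pre b rest m → is23 b ≡ false → All (λ l → is23 l ≡ true) rest →
    Realises a (pre ++ b ∷ rest) (double m) → Realises a (pre ++ rest) m
  realises-eliminate01 pre b []       m _     _            R =
    subst (λ ls → Realises a ls m) (sym (++-identityʳ pre))
          (realises-fewerRows (m≤double m) (realises-init pre b R))
    where
    m≤double : ∀ m → m ≤ double m
    m≤double m = subst (m ≤_) (sym (double≡2* m)) (ℕ.m≤m+n m (m + 0))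
  realises-eliminate01 pre b (L ∷ fs) m b∉23 (L∈23 ∷ _) R = realises-eliminate pre b L fs m b∉23 L∈23 R

  private
    reassoc : ∀ {pre l rest m} → Realises a ((pre ++ l ∷ []) ++ rest) m → Realises a (pre ++ l ∷ rest) m
    reassoc {pre} {l} {rest} {m} = subst (λ ls → Realises a ls m) (++-assoc pre (l ∷ []) rest)
    unassoc : ∀ {pre l rest m} → Realises a (pre ++ l ∷ rest) m → Realises a ((pre ++ l ∷ []) ++ rest) m
    unassoc {pre} {l} {rest} {m} = subst (λ ls → Realises a ls m) (sym (++-assoc pre (l ∷ []) rest))

  realises-letters23 : ∀ rest pre m → Realises a (pre ++ rest) (rowsNeeded m rest) →
    Realises a (pre ++ letters23 rest) m
  realises-letters23 []       pre m R = R
  realises-letters23 (l ∷ rest) pre m R with is23 l in l∈23?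
  ... | true  = reassoc (realises-letters23 rest (pre ++ l ∷ []) m (unassoc R))
  ... | false = realises-eliminate01 pre l (letters23 rest) m l∈23? (letters23-all rest)
                  (reassoc (realises-letters23 rest (pre ++ l ∷ []) (double m) (unassoc R)))

factor : Word → ℕ → ℕ → List Letter
factor α k zero    = []
factor α k (suc n) = α k ∷ factor α (suc k) n

length-factor : ∀ α k n → length (factor α k n) ≡ n
length-factor α k zero    = refl
length-factor α k (suc n) = cong suc (length-factor α (suc k) n)

wordOf-factor : ∀ α k {n j} → j < n → wordOf (factor α k n) j ≡ α (k + j)
wordOf-factor α k {suc n} {zero}  _        = cong α (sym (ℕ.+-identityʳ k))
wordOf-factor α k {suc n} {suc j} (s≤s j<) = trans (wordOf-factor α (suc k) j<) (cong α (sym (ℕ.+-suc k j)))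

-- The last letter of α_k ⋯ α_{k+p} is counted but is not a letter of the grid with p + 1 columns.
count23-≤-columns : ∀ α k p → count23 α k (suc p) ≤ suc (length (letters23 (factor α k p)))
count23-≤-columns α k zero    with is23 (α k)
... | true  = ℕ.≤-refl
... | false = z≤n
count23-≤-columns α k (suc p) with is23 (α k)
... | true  = s≤s (count23-≤-columns α (suc k) p)
... | false = count23-≤-columns α (suc k) p

count01+count23-≤ : ∀ α k p → count01 (factor α k p) + count23 α k (suc p) ≤ suc p
count01+count23-≤ α k zero    with is23 (α k)
... | true  = ℕ.≤-refl
... | false = z≤n
count01+count23-≤ α k (suc p) with is23 (α k)
... | true  = subst (_≤ suc (suc p)) (sym (ℕ.+-suc _ _)) (s≤s (count01+count23-≤ α (suc k) p))
... | false = s≤s (count01+count23-≤ α (suc k) p)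

rowsNeeded-factor : ∀ α k p q → count23 α k (suc p) ≡ q →
  rowsNeeded q (factor α k p) ≤ q * 2 ^ (suc p ∸ q)
rowsNeeded-factor α k p q count≡q = subst (_≤ q * 2 ^ (suc p ∸ q)) (sym (rowsNeeded≡ q ls))
  (ℕ.*-monoʳ-≤ q (ℕ.^-monoʳ-≤ 2 (ℕ.m+n≤o⇒m≤o∸n (count01 ls)
    (subst (λ c → count01 ls + c ≤ suc p) count≡q (count01+count23-≤ α k p)))))
  where ls = factor α k p

wordOf-23 : ∀ {ls} → All (λ l → is23 l ≡ true) ls → ∀ j → is23 (wordOf ls j) ≡ true
wordOf-23 []             _       = refl
wordOf-23 (l∈23 ∷ _)     zero    = l∈23
wordOf-23 (_ ∷ ls∈23)    (suc j) = wordOf-23 ls∈23 j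

toℕ-mod : ∀ {x} M .{{_ : NonZero M}} → x < M → toℕ (x mod M) ≡ x
toℕ-mod M x< = trans (Fin.toℕ-fromℕ< _) (m<n⇒m%n≡m x<)

realises-H : ∀ α k p M .{{_ : NonZero M}} → Realises (adj (H α 1 k M (suc p))) (factor α k p) M
realises-H α k p M = record
  { comps           = []
  ; label           = label
  ; label-injective = label-injective
  ; label-adj       = label-adj
  }
  where
  open ≡-Reasoning
  label : ℕ → ℕ → Fin (M * suc p)
  label x y = Fin.combine (x mod M) (y mod suc p)

  column< : ∀ {y} → y ≤ length (factor α k p) → y < suc p
  column< y≤ = s≤s (subst (_ ≤_) (length-factor α k p) y≤)

  label-injective : ∀ {x y x′ y′} → x < M → y ≤ length (factor α k p) → x′ < M →
    y′ ≤ length (factor α k p) → label x y ≡ label x′ y′ → x ≡ x′ × y ≡ y′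
  label-injective x< y≤ x′< y′≤ e with Fin.combine-injective _ _ _ _ e
  ... | e₁ , e₂ =
    trans (sym (toℕ-mod M x<)) (trans (cong toℕ e₁) (toℕ-mod M x′<)) ,
    trans (sym (toℕ-mod (suc p) (column< y≤))) (trans (cong toℕ e₂) (toℕ-mod (suc p) (column< y′≤)))

  label-adj : ∀ {x y x′ y′} → x < M → y ≤ length (factor α k p) → x′ < M →
    y′ ≤ length (factor α k p) →
    adj (H α 1 k M (suc p)) (label x y) (label x′ y′) ≡ adjP (wordOf (factor α k p)) x y x′ y′
  label-adj {x} {y} {x′} {y′} x< y≤ x′< y′≤ = begin
    adj (H α 1 k M (suc p)) (label x y) (label x′ y′)
      ≡⟨ cong₂ cellAdj (Fin.remQuot-combine (x mod M) (y mod suc p))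
                       (Fin.remQuot-combine (x′ mod M) (y′ mod suc p)) ⟩
    cellAdj (x mod M , y mod suc p) (x′ mod M , y′ mod suc p)
      ≡⟨ cong₂ (λ r r′ → adjP α (suc r) (k + toℕ (y mod suc p)) (suc r′) (k + toℕ (y′ mod suc p)))
           (toℕ-mod M x<) (toℕ-mod M x′<) ⟩
    adjP α (suc x) (k + toℕ (y mod suc p)) (suc x′) (k + toℕ (y′ mod suc p))
      ≡⟨ cong₂ (λ c c′ → adjP α (suc x) (k + c) (suc x′) (k + c′))
           (toℕ-mod (suc p) (column< y≤)) (toℕ-mod (suc p) (column< y′≤)) ⟩
    adjP α (suc x) (k + y) (suc x′) (k + y′)
      ≡⟨ adjP-shift α k x y x′ y′ ⟩
    adjP (λ j → α (k + j)) x y x′ y′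
      ≡⟨ adjP-cong p (λ j< → sym (wordOf-factor α k j<)) x x′
           (subst (_ ≤_) (length-factor α k p) y≤) (subst (_ ≤_) (length-factor α k p) y′≤) ⟩
    adjP (wordOf (factor α k p)) x y x′ y′ ∎
    where
    cellAdj : Fin M × Fin (suc p) → Fin M × Fin (suc p) → Bool
    cellAdj (r , c) (r′ , c′) = adjP α (1 + toℕ r) (k + toℕ c) (1 + toℕ r′) (k + toℕ c′)

vertexMinor-grid : ∀ {n} {a : Adjacency n} {ls q} → q ≤ suc (length ls) → Realises a ls q →
  VertexMinor (H (wordOf ls ∘ pred) 1 1 q q) (mkGraph n a)
vertexMinor-grid {n} {a} {ls} {q} q≤ R =
  vertexMinor-localComps a comps (vertexMinor-embedding n (localComps a comps) g g-injective g-adj)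
  where
  open Realises R
  γ = wordOf ls ∘ pred
  row : Fin (q * q) → Fin q
  row t = proj₁ (Fin.remQuot {q} q t)
  col : Fin (q * q) → Fin q
  col t = proj₂ (Fin.remQuot {q} q t)
  g : Fin (q * q) → Fin n
  g t = label (toℕ (row t)) (toℕ (col t))
  row< : ∀ t → toℕ (row t) < q
  row< t = Fin.toℕ<n (row t)
  col≤ : ∀ t → toℕ (col t) ≤ length ls
  col≤ t = ℕ.≤-pred (ℕ.<-≤-trans (Fin.toℕ<n (col t)) q≤)
  g-injective : ∀ {s t} → g s ≡ g t → s ≡ t
  g-injective {s} {t} e with label-injective (row< s) (col≤ s) (row< t) (col≤ t) e
  ... | e₁ , e₂ = begin
    s
      ≡⟨ Fin.combine-remQuot {q} q s ⟨
    Fin.combine (row s) (col s)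
      ≡⟨ cong₂ Fin.combine (Fin.toℕ-injective e₁) (Fin.toℕ-injective e₂) ⟩
    Fin.combine (row t) (col t)
      ≡⟨ Fin.combine-remQuot {q} q t ⟩
    t ∎
    where open ≡-Reasoning
  g-adj : ∀ s t → localComps a comps (g s) (g t) ≡ adj (H γ 1 1 q q) s t
  g-adj s t = trans (label-adj (row< s) (col≤ s) (row< t) (col≤ t))
                    (sym (adjP-shift γ 1 (toℕ (row s)) (toℕ (col s)) (toℕ (row t)) (toℕ (col t))))

lemma3p9 : (α : Word) → InfinitelyMany23 α →
    (k p q : ℕ) → 1 ≤ k → count23 α k p ≡ q → 0 < q → q ≤ p →
    Σ Word λ γ → (∀ j → is23 (γ j) ≡ true) ×
      VertexMinor (H γ 1 1 q q) (H α 1 k ((q + 4) * 2 ^ (p ∸ q)) p)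
lemma3p9 α _ k zero    q _ _       0<q q≤0 = contradiction (ℕ.<-≤-trans 0<q q≤0) λ ()
lemma3p9 α _ k (suc p) q _ count≡q 0<q _   =
  wordOf L23 ∘ pred , wordOf-23 (letters23-all ls) ∘ pred ,
  vertexMinor-grid (subst (_≤ _) count≡q (count23-≤-columns α k p))
    (realises-letters23 ls [] q (realises-fewerRows rows≤ (realises-H α k p M)))
  where
  ls  = factor α k p
  L23 = letters23 ls
  M   = (q + 4) * 2 ^ (suc p ∸ q)
  instance
    M≢0 : NonZero M
    M≢0 = ℕ.m*n≢0 (q + 4) _ {{>-nonZero (ℕ.<-≤-trans 0<q (ℕ.m≤m+n q 4))}} {{ℕ.m^n≢0 2 (suc p ∸ q)}}
  -- q rows would do in place of the q + 4 of the statement.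
  rows≤ : rowsNeeded q ls ≤ M
  rows≤ = ℕ.≤-trans (rowsNeeded-factor α k p q count≡q) (ℕ.*-monoˡ-≤ _ (ℕ.m≤m+n q 4))
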